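{- For every formula $F$, if $F$ is provable in $\mathsf{IL}+\mathsf{EM}_1^-$, then $F$ is provable in $\mathsf{IL}+\mathsf{MP}$.
   Context: Formulas of first-order logic are built from atomic formulas and $\bot$ using $\land,\lor,\rightarrow,\forall,\exists$, with $\lnot A:=A\rightarrow\bot$. A propositional formula is quantifier-free; it is negative if $\lor$ does not occur in it. $\mathsf{IL}+\mathsf{MP}$ is intuitionistic first-order natural deduction extended with the scheme $\lnot\lnot\exists\alpha\,P\rightarrow\exists\alpha\,P$ for every propositional formula $P$. $\mathsf{IL}+\mathsf{EM}_1^-$ is intuitionistic first-order natural deduction (including the axiom $\bot\rightarrow P$) extended with: the axioms $\Gamma, P\vdash P$ for negative propositional $P$; the rule $\mathsf{EM}_0$: from $\Gamma,\lnot P\vdash C$ and $\Gamma,P\vdash C$ infer $\Gamma\vdash C$, for $P$ negative propositional and $C$ arbitrary; and the rule $\mathsf{EM}_1^-$: from $\Gamma,\forall\alpha\,P\vdash\exists\beta\,Q$ and $\Gamma,\exists\alpha\,\lnot P\vdash\exists\beta\,Q$ infer $\Gamma\vdash\exists\beta\,Q$, for $P,Q$ negative propositional formulas. -}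

module Defs where

open import Data.Nat using (ℕ; zero; suc)
open import Data.Vec using (Vec; []; _∷_)
open import Data.List using (List; []; _∷_; map)
open import Data.List.Membership.Propositional using (_∈_)
open import Data.Empty using (⊥)
open import Data.Unit using (⊤)
open import Data.Product using (_×_)

record Signature : Set₁ where
  field
    Fun    : Set
    farity : Fun → ℕ
    Pred   : Set
    parity : Pred → ℕ

data System : Set where
  IL+MP   : System
  IL+EM1⁻ : System

module FOL (L : Signature) where
  open Signature L

  -- Terms, variables as de Bruijn indices.
  data Term : Set where
    var : ℕ → Term
    fun : (f : Fun) → Vec Term (farity f) → Term

  data Formula : Set where
    atom : (p : Pred) → Vec Term (parity p) → Formula
    ⊥'   : Formula
    _∧'_ : Formula → Formula → Formula
    _∨'_ : Formula → Formula → Formula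
    _⇒_  : Formula → Formula → Formula
    ∀'   : Formula → Formula
    ∃'   : Formula → Formula

  infixr 6 _∧'_
  infixr 5 _∨'_
  infixr 4 _⇒_

  ¬' : Formula → Formula
  ¬' A = A ⇒ ⊥'

  Subst : Set
  Subst = ℕ → Term

  mutual
    tsub : Subst → Term → Term
    tsub σ (var n)    = σ n
    tsub σ (fun f ts) = fun f (tsubs σ ts)

    tsubs : ∀ {n} → Subst → Vec Term n → Vec Term n
    tsubs σ []       = []
    tsubs σ (t ∷ ts) = tsub σ t ∷ tsubs σ ts

  exts : Subst → Subst
  exts σ zero    = var zero
  exts σ (suc n) = tsub (λ m → var (suc m)) (σ n)

  fsub : Subst → Formula → Formula
  fsub σ (atom p ts) = atom p (tsubs σ ts)
  fsub σ ⊥'          = ⊥'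
  fsub σ (A ∧' B)    = fsub σ A ∧' fsub σ B
  fsub σ (A ∨' B)    = fsub σ A ∨' fsub σ B
  fsub σ (A ⇒ B)     = fsub σ A ⇒ fsub σ B
  fsub σ (∀' A)      = ∀' (fsub (exts σ) A)
  fsub σ (∃' A)      = ∃' (fsub (exts σ) A)

  shift : Formula → Formula
  shift = fsub (λ n → var (suc n))

  _[_] : Formula → Term → Formula
  A [ t ] = fsub σ A
    where
      σ : Subst
      σ zero    = t
      σ (suc n) = var n

  Propositional : Formula → Set
  Propositional (atom p ts) = ⊤
  Propositional ⊥'          = ⊤
  Propositional (A ∧' B)    = Propositional A × Propositional B
  Propositional (A ∨' B)    = Propositional A × Propositional B
  Propositional (A ⇒ B)     = Propositional A × Propositional B
  Propositional (∀' A)      = ⊥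
  Propositional (∃' A)      = ⊥

  NegProp : Formula → Set
  NegProp (atom p ts) = ⊤
  NegProp ⊥'          = ⊤
  NegProp (A ∧' B)    = NegProp A × NegProp B
  NegProp (A ∨' B)    = ⊥
  NegProp (A ⇒ B)     = NegProp A × NegProp B
  NegProp (∀' A)      = ⊥
  NegProp (∃' A)      = ⊥

  Ctx : Set
  Ctx = List Formula

  data _⊢[_]_ : Ctx → System → Formula → Set where
    ax   : ∀ {S Γ A} → A ∈ Γ → Γ ⊢[ S ] A
    ⊥E   : ∀ {S Γ A} → Γ ⊢[ S ] ⊥' → Γ ⊢[ S ] A
    ∧I   : ∀ {S Γ A B} → Γ ⊢[ S ] A → Γ ⊢[ S ] B → Γ ⊢[ S ] (A ∧' B)
    ∧E₁  : ∀ {S Γ A B} → Γ ⊢[ S ] (A ∧' B) → Γ ⊢[ S ] A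
    ∧E₂  : ∀ {S Γ A B} → Γ ⊢[ S ] (A ∧' B) → Γ ⊢[ S ] B
    ∨I₁  : ∀ {S Γ A B} → Γ ⊢[ S ] A → Γ ⊢[ S ] (A ∨' B)
    ∨I₂  : ∀ {S Γ A B} → Γ ⊢[ S ] B → Γ ⊢[ S ] (A ∨' B)
    ∨E   : ∀ {S Γ A B C} → Γ ⊢[ S ] (A ∨' B) → (A ∷ Γ) ⊢[ S ] C → (B ∷ Γ) ⊢[ S ] C
           → Γ ⊢[ S ] C
    ⇒I   : ∀ {S Γ A B} → (A ∷ Γ) ⊢[ S ] B → Γ ⊢[ S ] (A ⇒ B)
    ⇒E   : ∀ {S Γ A B} → Γ ⊢[ S ] (A ⇒ B) → Γ ⊢[ S ] A → Γ ⊢[ S ] B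
    ∀I   : ∀ {S Γ A} → map shift Γ ⊢[ S ] A → Γ ⊢[ S ] ∀' A
    ∀E   : ∀ {S Γ A} → Γ ⊢[ S ] ∀' A → (t : Term) → Γ ⊢[ S ] (A [ t ])
    ∃I   : ∀ {S Γ A} → (t : Term) → Γ ⊢[ S ] (A [ t ]) → Γ ⊢[ S ] ∃' A
    ∃E   : ∀ {S Γ A C} → Γ ⊢[ S ] ∃' A → (A ∷ map shift Γ) ⊢[ S ] shift C
           → Γ ⊢[ S ] C
    mp   : ∀ {Γ P} → Propositional P → Γ ⊢[ IL+MP ] (¬' (¬' (∃' P)) ⇒ ∃' P)
    em₀  : ∀ {Γ P C} → NegProp P
           → (¬' P ∷ Γ) ⊢[ IL+EM1⁻ ] C → (P ∷ Γ) ⊢[ IL+EM1⁻ ] C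
           → Γ ⊢[ IL+EM1⁻ ] C
    em₁⁻ : ∀ {Γ P Q} → NegProp P → NegProp Q
           → (∀' P ∷ Γ) ⊢[ IL+EM1⁻ ] ∃' Q → (∃' (¬' P) ∷ Γ) ⊢[ IL+EM1⁻ ] ∃' Q
           → Γ ⊢[ IL+EM1⁻ ] ∃' Q

  Provable : System → Formula → Set
  Provable S F = [] ⊢[ S ] F

-- Markov's principle for a vacuous quantifier, ¬¬∃α P → ∃α P with α not free in P,
-- already gives stability ¬¬P → P of every quantifier-free P, hence excluded middle
-- P ∨ ¬P, which interprets EM₀. For EM₁⁻ assume ¬∃β Q: both premises then refute
-- their hypothesis, so ¬∀α P and ¬∃α ¬P; the latter gives ¬¬P for each α, stability
-- gives ∀α P, a contradiction. Hence ¬¬∃β Q, and Markov's principle yields ∃β Q.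
module Submission where

open import Defs
open import Data.Nat using (zero; suc)
open import Data.Vec using (Vec; []; _∷_)
open import Data.List using (_∷_)
open import Data.List.Relation.Unary.Any using (here; there)
open import Data.Unit using (tt)
open import Data.Product using (_,_)
open import Relation.Binary.PropositionalEquality using (_≡_; refl; cong; cong₂)

module _ (L : Signature) where
  open FOL L

  mutual
    tsub-cancel : ∀ σ ρ → (∀ n → tsub σ (ρ n) ≡ var n) → ∀ t → tsub σ (tsub ρ t) ≡ t
    tsub-cancel σ ρ σρ≡var (var n)    = σρ≡var n
    tsub-cancel σ ρ σρ≡var (fun f ts) = cong (fun f) (tsubs-cancel σ ρ σρ≡var ts)

    tsubs-cancel : ∀ {k} σ ρ → (∀ n → tsub σ (ρ n) ≡ var n) →
                   (ts : Vec Term k) → tsubs σ (tsubs ρ ts) ≡ ts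
    tsubs-cancel σ ρ σρ≡var []       = refl
    tsubs-cancel σ ρ σρ≡var (t ∷ ts) =
      cong₂ _∷_ (tsub-cancel σ ρ σρ≡var t) (tsubs-cancel σ ρ σρ≡var ts)

  fsub-cancel : ∀ σ ρ → (∀ n → tsub σ (ρ n) ≡ var n) →
                ∀ A → Propositional A → fsub σ (fsub ρ A) ≡ A
  fsub-cancel σ ρ σρ≡var (atom p ts) _     = cong (atom p) (tsubs-cancel σ ρ σρ≡var ts)
  fsub-cancel σ ρ σρ≡var ⊥'          _     = refl
  fsub-cancel σ ρ σρ≡var (A ∧' B) (pA , pB) =
    cong₂ _∧'_ (fsub-cancel σ ρ σρ≡var A pA) (fsub-cancel σ ρ σρ≡var B pB)
  fsub-cancel σ ρ σρ≡var (A ∨' B) (pA , pB) =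
    cong₂ _∨'_ (fsub-cancel σ ρ σρ≡var A pA) (fsub-cancel σ ρ σρ≡var B pB)
  fsub-cancel σ ρ σρ≡var (A ⇒ B)  (pA , pB) =
    cong₂ _⇒_ (fsub-cancel σ ρ σρ≡var A pA) (fsub-cancel σ ρ σρ≡var B pB)

  shift-[var0] : ∀ A → Propositional A → shift A [ var 0 ] ≡ A
  shift-[var0] A = fsub-cancel _ _ (λ { zero → refl ; (suc n) → refl }) A

  -- This is the body of shift (∃' A) seen under its binder.
  exts-shift-[var0] : ∀ A → Propositional A → fsub (exts (λ n → var (suc n))) A [ var 0 ] ≡ A
  exts-shift-[var0] A = fsub-cancel _ _ (λ { zero → refl ; (suc n) → refl }) A

  Propositional-fsub : ∀ σ A → Propositional A → Propositional (fsub σ A)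
  Propositional-fsub σ (atom p ts) _        = tt
  Propositional-fsub σ ⊥'          _        = tt
  Propositional-fsub σ (A ∧' B) (pA , pB) = Propositional-fsub σ A pA , Propositional-fsub σ B pB
  Propositional-fsub σ (A ∨' B) (pA , pB) = Propositional-fsub σ A pA , Propositional-fsub σ B pB
  Propositional-fsub σ (A ⇒ B)  (pA , pB) = Propositional-fsub σ A pA , Propositional-fsub σ B pB

  NegProp⇒Propositional : ∀ A → NegProp A → Propositional A
  NegProp⇒Propositional (atom p ts) _        = tt
  NegProp⇒Propositional ⊥'          _        = tt
  NegProp⇒Propositional (A ∧' B) (nA , nB) =
    NegProp⇒Propositional A nA , NegProp⇒Propositional B nB
  NegProp⇒Propositional (A ⇒ B)  (nA , nB) =
    NegProp⇒Propositional A nA , NegProp⇒Propositional B nB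

  ∃I-≡ : ∀ {S Γ A B} t → A [ t ] ≡ B → Γ ⊢[ S ] B → Γ ⊢[ S ] ∃' A
  ∃I-≡ t refl ⊢B = ∃I t ⊢B

  ¬¬-stable : ∀ {Γ} A → Propositional A → Γ ⊢[ IL+MP ] (¬' (¬' A) ⇒ A)
  ¬¬-stable A pA =
    ⇒I (∃E (⇒E (mp (Propositional-fsub _ A pA)) ¬¬∃shiftA) (ax (here refl)))
    where
      ¬¬∃shiftA = ⇒I (⇒E (ax (there (here refl)))
                    (⇒I (⇒E (ax (there (here refl)))
                      (∃I-≡ (var 0) (shift-[var0] A pA) (ax (here refl))))))

  excluded-middle : ∀ {Γ} A → Propositional A → Γ ⊢[ IL+MP ] (A ∨' ¬' A)
  excluded-middle A pA = ⇒E (¬¬-stable (A ∨' ¬' A) (pA , pA , tt))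
    (⇒I (⇒E (ax (here refl)) (∨I₂ (⇒I (⇒E (ax (there (here refl))) (∨I₁ (ax (here refl))))))))

  em₁ : ∀ {Γ} P Q → Propositional P → Propositional Q →
        Γ ⊢[ IL+MP ] ((∀' P ⇒ ∃' Q) ⇒ (∃' (¬' P) ⇒ ∃' Q) ⇒ ∃' Q)
  em₁ P Q pP pQ = ⇒I (⇒I (⇒E (mp pQ) (⇒I (⇒E ¬∃Q (⇒E ∀P⇒∃Q (∀I ∀P))))))
    where
      ¬∃Q    = ax (here refl)
      ∀P⇒∃Q = ax (there (there (here refl)))
      ∀P = ⇒E (¬¬-stable P pP)
             (⇒I (⇒E (ax (there (here refl)))
               (⇒E (ax (there (there (here refl))))
                 (∃I-≡ (var 0) (cong (_⇒ ⊥') (exts-shift-[var0] P pP)) (ax (here refl))))))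

  ⊢⇒⊢IL+MP : ∀ {S Γ A} → Γ ⊢[ S ] A → Γ ⊢[ IL+MP ] A
  ⊢⇒⊢IL+MP (ax A∈Γ)     = ax A∈Γ
  ⊢⇒⊢IL+MP (⊥E d)       = ⊥E (⊢⇒⊢IL+MP d)
  ⊢⇒⊢IL+MP (∧I d e)     = ∧I (⊢⇒⊢IL+MP d) (⊢⇒⊢IL+MP e)
  ⊢⇒⊢IL+MP (∧E₁ d)      = ∧E₁ (⊢⇒⊢IL+MP d)
  ⊢⇒⊢IL+MP (∧E₂ d)      = ∧E₂ (⊢⇒⊢IL+MP d)
  ⊢⇒⊢IL+MP (∨I₁ d)      = ∨I₁ (⊢⇒⊢IL+MP d)
  ⊢⇒⊢IL+MP (∨I₂ d)      = ∨I₂ (⊢⇒⊢IL+MP d)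
  ⊢⇒⊢IL+MP (∨E d e f)   = ∨E (⊢⇒⊢IL+MP d) (⊢⇒⊢IL+MP e) (⊢⇒⊢IL+MP f)
  ⊢⇒⊢IL+MP (⇒I d)       = ⇒I (⊢⇒⊢IL+MP d)
  ⊢⇒⊢IL+MP (⇒E d e)     = ⇒E (⊢⇒⊢IL+MP d) (⊢⇒⊢IL+MP e)
  ⊢⇒⊢IL+MP (∀I d)       = ∀I (⊢⇒⊢IL+MP d)
  ⊢⇒⊢IL+MP (∀E d t)     = ∀E (⊢⇒⊢IL+MP d) t
  ⊢⇒⊢IL+MP (∃I t d)     = ∃I t (⊢⇒⊢IL+MP d)
  ⊢⇒⊢IL+MP (∃E d e)     = ∃E (⊢⇒⊢IL+MP d) (⊢⇒⊢IL+MP e)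
  ⊢⇒⊢IL+MP (mp pP)      = mp pP
  ⊢⇒⊢IL+MP (em₀ {P = P} nP ¬P⊢C P⊢C) =
    ∨E (excluded-middle P (NegProp⇒Propositional P nP)) (⊢⇒⊢IL+MP P⊢C) (⊢⇒⊢IL+MP ¬P⊢C)
  ⊢⇒⊢IL+MP (em₁⁻ {P = P} {Q} nP nQ ∀P⊢∃Q ∃¬P⊢∃Q) =
    ⇒E (⇒E (em₁ P Q (NegProp⇒Propositional P nP) (NegProp⇒Propositional Q nQ))
            (⇒I (⊢⇒⊢IL+MP ∀P⊢∃Q)))
       (⇒I (⊢⇒⊢IL+MP ∃¬P⊢∃Q))

theorem3p4 : (L : Signature) (F : FOL.Formula L)
    → FOL.Provable L IL+EM1⁻ F → FOL.Provable L IL+MP F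
theorem3p4 L F = ⊢⇒⊢IL+MP L
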